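{- Let $n\ge 1$ and let $A$ and $B$ be $n\times n\times n$ alternating sign hypermatrices. Then $L(A)=L(B)$ if and only if $A-B$ can be expressed as a (finite, possibly empty) sum of pairs of T-blocks, where the two T-blocks in each pair have opposite depth and occupy the same vertical lines.
   Context: An $n\times n\times n$ hypermatrix $A=[a_{ijk}]$ has row lines $(a_{ijk})_{i=1}^n$ (fixed $j,k$), column lines $(a_{ijk})_{j=1}^n$ (fixed $i,k$) and vertical lines $V_{ij}=(a_{ijk})_{k=1}^n$ (fixed $i,j$). Its $k$-th plane is the $n\times n$ matrix $P_k(A)=[a_{ijk}]_{i,j=1}^n$. An alternating sign hypermatrix (ASHM) is an $n\times n\times n$ $\{0,1,-1\}$-hypermatrix in which the non-zero entries of every row line, column line and vertical line alternate in sign, beginning and ending with $+1$. For an ASHM $A$, its ASHL is the $n\times n$ matrix $L(A)=\sum_{k=1}^n k\,P_k(A)$. For $i_1<i_2$, $j_1<j_2$, $k_1<k_2$, the hypermatrix $T_{i_1,j_1,k_1:\,i_2,j_2,k_2}=[t_{ijk}]$ has $t_{ijk}=1$ at $(i_1,j_1,k_1),(i_2,j_2,k_1),(i_2,j_1,k_2),(i_1,j_2,k_2)$, $t_{ijk}=-1$ at $(i_2,j_1,k_1),(i_1,j_2,k_1),(i_1,j_1,k_2),(i_2,j_2,k_2)$, and $0$ elsewhere. A T-block is a hypermatrix $T=\pm T_{i_1,j_1,k_1:\,i_2,j_2,k_2}$; its depth is $d(T)=k_2-k_1$ if $T=T_{i_1,j_1,k_1:\,i_2,j_2,k_2}$ and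 $d(T)=k_1-k_2$ if $T=-T_{i_1,j_1,k_1:\,i_2,j_2,k_2}$. Two T-blocks $T_1,T_2$ have opposite depth if $d(T_1)=-d(T_2)$. A T-block occupies the vertical lines $V_{ij}$ in which it has non-zero entries (namely those with $i\in\{i_1,i_2\}$, $j\in\{j_1,j_2\}$); two T-blocks occupy the same vertical lines if these sets of vertical lines coincide. -}

module Defs where

open import Data.Nat using (ℕ; zero; suc)
open import Data.Fin using (Fin; toℕ; _<_)
open import Data.Integer using (ℤ; +_; -_; _+_; _-_; _*_; 0ℤ; 1ℤ; -1ℤ)
open import Data.List using (List; []; _∷_; filterᵇ; foldr)
open import Data.Vec.Functional using (Vector; toList)
open import Data.Sign using (Sign) renaming (+ to plus; - to minus)
open import Data.Product using (_×_; Σ; ∃; _,_)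
open import Data.Sum using (_⊎_)
open import Data.Bool using (Bool; true; false; not)
open import Relation.Binary.PropositionalEquality using (_≡_)
open import Relation.Nullary.Decidable using (⌊_⌋)
import Data.Integer.Properties as ℤP
import Data.Fin.Properties as FinP
open import Function.Bundles using (_⇔_)

Hypermatrix : ℕ → Set
Hypermatrix n = Fin n → Fin n → Fin n → ℤ

IsSignEntry : ℤ → Set
IsSignEntry x = (x ≡ 0ℤ) ⊎ ((x ≡ 1ℤ) ⊎ (x ≡ -1ℤ))

data AltList : List ℤ → Set where
  single : AltList (1ℤ ∷ [])
  step   : ∀ {xs} → AltList xs → AltList (1ℤ ∷ -1ℤ ∷ xs)

nonZeros : ∀ {n} → Vector ℤ n → List ℤ
nonZeros v = filterᵇ (λ x → not ⌊ x ℤP.≟ 0ℤ ⌋) (toList v)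

AltLine : ∀ {n} → Vector ℤ n → Set
AltLine v = AltList (nonZeros v)

record IsASHM {n : ℕ} (A : Hypermatrix n) : Set where
  field
    entries  : ∀ i j k → IsSignEntry (A i j k)
    rowLines : ∀ j k → AltLine (λ i → A i j k)
    colLines : ∀ i k → AltLine (λ j → A i j k)
    vertLines : ∀ i j → AltLine (λ k → A i j k)

Σℤ : ∀ {n} → (Fin n → ℤ) → ℤ
Σℤ {n} f = foldr _+_ 0ℤ (toList f)

-- ASHL: L(A) = Σ_{k=1}^n k P_k(A); plane index k : Fin n corresponds to k+1.
ASHL : ∀ {n} → Hypermatrix n → Fin n → Fin n → ℤ
ASHL A i j = Σℤ (λ k → (+ suc (toℕ k)) * A i j k)

σ : ∀ {n} → Fin n → Fin n → Fin n → ℤ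
σ a b x with ⌊ x FinP.≟ a ⌋ | ⌊ x FinP.≟ b ⌋
... | true  | _     = 1ℤ
... | false | true  = -1ℤ
... | false | false = 0ℤ

signℤ : Sign → ℤ
signℤ plus  = 1ℤ
signℤ minus = -1ℤ

record TBlock (n : ℕ) : Set where
  field
    sign : Sign
    i₁ i₂ j₁ j₂ k₁ k₂ : Fin n
    i₁<i₂ : i₁ < i₂
    j₁<j₂ : j₁ < j₂
    k₁<k₂ : k₁ < k₂

-- T_{i1,j1,k1:i2,j2,k2} has entry σ_i σ_j σ_k, which is +1 at (i1,j1,k1),(i2,j2,k1),
-- (i2,j1,k2),(i1,j2,k2), -1 at (i2,j1,k1),(i1,j2,k1),(i1,j1,k2),(i2,j2,k2), 0 elsewhere.
tblock : ∀ {n} → TBlock n → Hypermatrix n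
tblock T i j k = signℤ sign * (σ i₁ i₂ i * (σ j₁ j₂ j * σ k₁ k₂ k))
  where open TBlock T

depth : ∀ {n} → TBlock n → ℤ
depth T with TBlock.sign T
... | plus  = (+ toℕ (TBlock.k₂ T)) - (+ toℕ (TBlock.k₁ T))
... | minus = (+ toℕ (TBlock.k₁ T)) - (+ toℕ (TBlock.k₂ T))

Occupies : ∀ {n} → TBlock n → Fin n → Fin n → Set
Occupies T i j = ((i ≡ TBlock.i₁ T) ⊎ (i ≡ TBlock.i₂ T)) × ((j ≡ TBlock.j₁ T) ⊎ (j ≡ TBlock.j₂ T))

record TPair (n : ℕ) : Set where
  field
    fst snd : TBlock n
    opposite : depth fst ≡ - depth snd
    sameLines : ∀ i j → Occupies fst i j ⇔ Occupies snd i j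

pairHM : ∀ {n} → TPair n → Hypermatrix n
pairHM P i j k = tblock (TPair.fst P) i j k + tblock (TPair.snd P) i j k

sumPairs : ∀ {n} → List (TPair n) → Hypermatrix n
sumPairs []       i j k = 0ℤ
sumPairs (P ∷ ps) i j k = pairHM P i j k + sumPairs ps i j k

-- Write D = A − B and call  Σ_k (k+1)·H_ijk  the moment of H on the vertical line V_ij.
-- Since L is linear, L(A) = L(B) iff D has zero moment on every vertical line.
--
-- (⇐) The moment of ±T_{i₁,j₁,k₁:i₂,j₂,k₂} on V_ij is σ_{i₁i₂}(i)·σ_{j₁j₂}(j)·(−depth).
--     Two T-blocks on the same vertical lines have the same i₁,i₂,j₁,j₂, so the moments
--     of a pair of opposite depth cancel; hence every sum of such pairs has zero moment.
-- (⇒) Every line of an ASHM sums to 1, so D has zero line sums in all three directions,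
--     besides zero moment.  Writing e_x for unit vectors, g_x = e_x − e_0 and
--     f_k = (e_k − e_0) − k(e_1 − e_0), two one-dimensional reconstruction formulas
--     (v = Σ_x v_x g_x if Σ v = 0;  v = Σ_k v_k f_k if moreover Σ k v_k = 0) give
--     D = Σ_{x,y,k} D_xyk · g_x ⊗ g_y ⊗ f_k.  Each generator g_x ⊗ g_y ⊗ f_k telescopes
--     into k pairs {+T_{0,0,0:x,y,1}, −T_{0,0,l:x,y,l+1}}, and pair sums are closed under
--     integer linear combinations, so D is a pair sum.
module Submission where

open import Data.Nat as ℕ using (ℕ; zero; suc; _≥_; s≤s; z≤n)
import Data.Nat.Properties as ℕP
open import Data.Fin as F using (Fin; zero; suc; toℕ; fromℕ<)
import Data.Fin.Properties as FP
open import Data.Integer using (ℤ; +_; -_; _+_; _-_; _*_; 0ℤ; 1ℤ; -1ℤ; -[1+_])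
import Data.Integer.Properties as ℤP
open import Data.Integer.Tactic.RingSolver using (solve-∀)
open import Algebra.Properties.Semiring.Sum ℤP.+-*-semiring
  using (sum; sum-syntax; sum-cong-≗; ∑-distrib-+; *-distribˡ-sum; sum-replicate-zero)
open import Data.List using (List; []; _∷_; _++_; map; filterᵇ; foldr)
open import Data.Vec.Functional using (Vector; toList)
open import Data.Bool using (not)
open import Data.Product using (∃; _,_; _×_; proj₁; proj₂)
open import Data.Sum using (_⊎_; inj₁; inj₂)
open import Data.Sign using (Sign) renaming (+ to plus; - to minus)
open import Data.Empty using (⊥-elim)
open import Function using (id; _∘_)
open import Function.Bundles using (_⇔_; mk⇔; Equivalence)
open import Relation.Nullary using (yes; no)
open import Relation.Nullary.Decidable using (⌊_⌋)
open import Relation.Binary.PropositionalEquality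
open ≡-Reasoning

open import Defs

Σℤ≡sum : ∀ {n} (f : Vector ℤ n) → Σℤ f ≡ sum f
Σℤ≡sum {zero}  f = refl
Σℤ≡sum {suc n} f = cong (_+_ (f zero)) (Σℤ≡sum (f ∘ suc))

∑-distrib-− : ∀ {n} (f g : Vector ℤ n) → ∑[ i < n ] (f i - g i) ≡ sum f - sum g
∑-distrib-− {zero}  f g = refl
∑-distrib-− {suc n} f g =
  trans (cong (_+_ (f zero - g zero)) (∑-distrib-− (f ∘ suc) (g ∘ suc)))
        (interchange (f zero) (g zero) (sum (f ∘ suc)) (sum (g ∘ suc)))
  where
  interchange : ∀ a b c d → (a - b) + (c - d) ≡ (a + c) - (b + d)
  interchange = solve-∀

*-distribˡ-− : ∀ c a b → c * (a - b) ≡ c * a - c * b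
*-distribˡ-− = solve-∀

δ : ℕ → ℕ → ℤ
δ zero    zero    = 1ℤ
δ zero    (suc _) = 0ℤ
δ (suc _) zero    = 0ℤ
δ (suc m) (suc k) = δ m k

δ-sym : ∀ m k → δ m k ≡ δ k m
δ-sym zero    zero    = refl
δ-sym zero    (suc k) = refl
δ-sym (suc m) zero    = refl
δ-sym (suc m) (suc k) = δ-sym m k

δ-refl : ∀ m → δ m m ≡ 1ℤ
δ-refl zero    = refl
δ-refl (suc m) = δ-refl m

δ-≢ : ∀ m k → m ≢ k → δ m k ≡ 0ℤ
δ-≢ zero    zero    m≢k = ⊥-elim (m≢k refl)
δ-≢ zero    (suc k) m≢k = refl
δ-≢ (suc m) zero    m≢k = refl
δ-≢ (suc m) (suc k) m≢k = δ-≢ m k (m≢k ∘ cong suc)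

-- The k-th unit vector of ℤⁿ (the zero vector when k ≥ n).
e : ∀ {n} → ℕ → Vector ℤ n
e k x = δ (toℕ x) k

∑-e : ∀ {n} (f : Vector ℤ n) (a : Fin n) → ∑[ x < n ] (f x * e (toℕ a) x) ≡ f a
∑-e {suc n} f zero = begin
  f zero * 1ℤ + ∑[ x < n ] (f (suc x) * 0ℤ) ≡⟨ cong₂ _+_ (ℤP.*-identityʳ (f zero)) tail-zero ⟩
  f zero + 0ℤ                              ≡⟨ ℤP.+-identityʳ (f zero) ⟩
  f zero                                   ∎
  where
  tail-zero : ∑[ x < n ] (f (suc x) * 0ℤ) ≡ 0ℤ
  tail-zero = trans (sum-cong-≗ (ℤP.*-zeroʳ ∘ f ∘ suc)) (sum-replicate-zero n)
∑-e {suc n} f (suc a) =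
  trans (cong (λ z → z + ∑[ x < n ] (f (suc x) * e (toℕ a) x)) (ℤP.*-zeroʳ (f zero)))
        (trans (ℤP.+-identityˡ _) (∑-e (f ∘ suc) a))

σ≡e−e : ∀ {n} (a b x : Fin n) → a ≢ b → σ a b x ≡ e (toℕ a) x - e (toℕ b) x
σ≡e−e a b x a≢b with x FP.≟ a | x FP.≟ b
... | yes refl | _
  rewrite δ-refl (toℕ x) | δ-≢ (toℕ x) (toℕ b) (a≢b ∘ FP.toℕ-injective) = refl
... | no x≢a | yes refl
  rewrite δ-refl (toℕ x) | δ-≢ (toℕ x) (toℕ a) (x≢a ∘ FP.toℕ-injective) = refl
... | no x≢a | no x≢b
  rewrite δ-≢ (toℕ x) (toℕ a) (x≢a ∘ FP.toℕ-injective)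
        | δ-≢ (toℕ x) (toℕ b) (x≢b ∘ FP.toℕ-injective) = refl

listSum : List ℤ → ℤ
listSum = foldr _+_ 0ℤ

listSum-dropZeros : ∀ xs → listSum (filterᵇ (λ x → not ⌊ x ℤP.≟ 0ℤ ⌋) xs) ≡ listSum xs
listSum-dropZeros []       = refl
listSum-dropZeros (x ∷ xs) with x ℤP.≟ 0ℤ
... | yes refl = trans (listSum-dropZeros xs) (sym (ℤP.+-identityˡ _))
... | no  _    = cong (_+_ x) (listSum-dropZeros xs)

listSum-alt : ∀ {xs} → AltList xs → listSum xs ≡ 1ℤ
listSum-alt single = refl
listSum-alt (step alt) rewrite listSum-alt alt = refl

altLine-sum : ∀ {n} (v : Vector ℤ n) → AltLine v → sum v ≡ 1ℤ
altLine-sum v alt = begin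
  sum v                  ≡⟨ Σℤ≡sum v ⟨
  listSum (toList v)     ≡⟨ listSum-dropZeros (toList v) ⟨
  listSum (nonZeros v)   ≡⟨ listSum-alt alt ⟩
  1ℤ                     ∎

record Balanced {n : ℕ} (D : Hypermatrix n) : Set where
  field
    rowSums  : ∀ j k → ∑[ i < n ] D i j k ≡ 0ℤ
    colSums  : ∀ i k → ∑[ j < n ] D i j k ≡ 0ℤ
    vertSums : ∀ i j → ∑[ k < n ] D i j k ≡ 0ℤ

ashm-difference-balanced : ∀ {n} {A B : Hypermatrix n} → IsASHM A → IsASHM B →
  Balanced (λ i j k → A i j k - B i j k)
ashm-difference-balanced {A = A} {B} isA isB = record
  { rowSums  = λ j k → difference (λ i → A i j k) (λ i → B i j k)
                         (IsASHM.rowLines isA j k) (IsASHM.rowLines isB j k)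
  ; colSums  = λ i k → difference (λ j → A i j k) (λ j → B i j k)
                         (IsASHM.colLines isA i k) (IsASHM.colLines isB i k)
  ; vertSums = λ i j → difference (λ k → A i j k) (λ k → B i j k)
                         (IsASHM.vertLines isA i j) (IsASHM.vertLines isB i j)
  }
  where
  difference : ∀ {n} (v w : Vector ℤ n) → AltLine v → AltLine w → ∑[ x < n ] (v x - w x) ≡ 0ℤ
  difference v w altv altw =
    trans (∑-distrib-− v w) (cong₂ _-_ (altLine-sum v altv) (altLine-sum w altw))

IsPairSum : ∀ {n} → Hypermatrix n → Set
IsPairSum {n} H = ∃ λ (ps : List (TPair n)) → ∀ i j k → H i j k ≡ sumPairs ps i j k

pairSum-≗ : ∀ {n} {H H′ : Hypermatrix n} → (∀ i j k → H i j k ≡ H′ i j k) →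
  IsPairSum H → IsPairSum H′
pairSum-≗ H≗H′ (ps , H≡ps) = ps , λ i j k → trans (sym (H≗H′ i j k)) (H≡ps i j k)

pairSum-zero : ∀ {n} → IsPairSum {n} (λ _ _ _ → 0ℤ)
pairSum-zero = [] , λ _ _ _ → refl

sumPairs-++ : ∀ {n} (ps qs : List (TPair n)) i j k →
  sumPairs (ps ++ qs) i j k ≡ sumPairs ps i j k + sumPairs qs i j k
sumPairs-++ []       qs i j k = sym (ℤP.+-identityˡ _)
sumPairs-++ (p ∷ ps) qs i j k =
  trans (cong (_+_ (pairHM p i j k)) (sumPairs-++ ps qs i j k)) (sym (ℤP.+-assoc (pairHM p i j k) _ _))

pairSum-+ : ∀ {n} {H H′ : Hypermatrix n} → IsPairSum H → IsPairSum H′ →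
  IsPairSum (λ i j k → H i j k + H′ i j k)
pairSum-+ (ps , H≡ps) (qs , H′≡qs) =
  ps ++ qs , λ i j k → trans (cong₂ _+_ (H≡ps i j k) (H′≡qs i j k)) (sym (sumPairs-++ ps qs i j k))

flipSign : Sign → Sign
flipSign plus  = minus
flipSign minus = plus

negBlock : ∀ {n} → TBlock n → TBlock n
negBlock T = record T { sign = flipSign (TBlock.sign T) }

negBlock-entries : ∀ {n} (T : TBlock n) i j k → tblock (negBlock T) i j k ≡ - tblock T i j k
negBlock-entries T i j k with TBlock.sign T
... | plus  = sym (ℤP.neg-distribˡ-* 1ℤ _)
... | minus = sym (ℤP.neg-distribˡ-* -1ℤ _)

sub-swap : ∀ a b → a - b ≡ - (b - a)
sub-swap = solve-∀

negBlock-depth : ∀ {n} (T : TBlock n) → depth (negBlock T) ≡ - depth T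
negBlock-depth T with TBlock.sign T
... | plus  = sub-swap (+ toℕ (TBlock.k₁ T)) (+ toℕ (TBlock.k₂ T))
... | minus = sub-swap (+ toℕ (TBlock.k₂ T)) (+ toℕ (TBlock.k₁ T))

negPair : ∀ {n} → TPair n → TPair n
negPair P = record
  { fst       = negBlock (TPair.fst P)
  ; snd       = negBlock (TPair.snd P)
  ; opposite  = begin
      depth (negBlock (TPair.fst P)) ≡⟨ negBlock-depth (TPair.fst P) ⟩
      - depth (TPair.fst P)          ≡⟨ cong -_ (TPair.opposite P) ⟩
      - - depth (TPair.snd P)        ≡⟨ cong -_ (negBlock-depth (TPair.snd P)) ⟨
      - depth (negBlock (TPair.snd P)) ∎
  ; sameLines = TPair.sameLines P
  }

negPair-entries : ∀ {n} (P : TPair n) i j k → pairHM (negPair P) i j k ≡ - pairHM P i j k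
negPair-entries P i j k =
  trans (cong₂ _+_ (negBlock-entries (TPair.fst P) i j k) (negBlock-entries (TPair.snd P) i j k))
        (sym (ℤP.neg-distrib-+ (tblock (TPair.fst P) i j k) _))

sumPairs-neg : ∀ {n} (ps : List (TPair n)) i j k → sumPairs (map negPair ps) i j k ≡ - sumPairs ps i j k
sumPairs-neg []       i j k = refl
sumPairs-neg (p ∷ ps) i j k =
  trans (cong₂ _+_ (negPair-entries p i j k) (sumPairs-neg ps i j k))
        (sym (ℤP.neg-distrib-+ (pairHM p i j k) _))

pairSum-neg : ∀ {n} {H : Hypermatrix n} → IsPairSum H → IsPairSum (λ i j k → - H i j k)
pairSum-neg (ps , H≡ps) =
  map negPair ps , λ i j k → trans (cong -_ (H≡ps i j k)) (sym (sumPairs-neg ps i j k))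

pairSum-scaleℕ : ∀ {n} {H : Hypermatrix n} (m : ℕ) → IsPairSum H → IsPairSum (λ i j k → + m * H i j k)
pairSum-scaleℕ {H = H} zero    _ = pairSum-≗ (λ i j k → sym (ℤP.*-zeroˡ (H i j k))) pairSum-zero
pairSum-scaleℕ {H = H} (suc m) s =
  pairSum-≗ (λ i j k → sym (unfold (+ m) (H i j k))) (pairSum-+ s (pairSum-scaleℕ m s))
  where
  unfold : ∀ m h → (1ℤ + m) * h ≡ h + m * h
  unfold = solve-∀

pairSum-scale : ∀ {n} {H : Hypermatrix n} (c : ℤ) → IsPairSum H → IsPairSum (λ i j k → c * H i j k)
pairSum-scale       (+ m)    s = pairSum-scaleℕ m s
pairSum-scale {H = H} -[1+ m ] s =
  pairSum-≗ (λ i j k → ℤP.neg-distribˡ-* (+ suc m) (H i j k)) (pairSum-neg (pairSum-scaleℕ (suc m) s))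

pairSum-∑ : ∀ {n m} (F : Fin m → Hypermatrix n) → (∀ x → IsPairSum (F x)) →
  IsPairSum (λ a b c → ∑[ x < m ] F x a b c)
pairSum-∑ {m = zero}  F s = pairSum-zero
pairSum-∑ {m = suc m} F s = pairSum-+ (s zero) (pairSum-∑ (F ∘ suc) (s ∘ suc))

pairSum-pair : ∀ {n} (P : TPair n) → IsPairSum (pairHM P)
pairSum-pair P = P ∷ [] , λ i j k → sym (ℤP.+-identityʳ (pairHM P i j k))

weight : ∀ {n} → Fin n → ℤ
weight k = + suc (toℕ k)

moment : ∀ {n} → Vector ℤ n → ℤ
moment {n} v = ∑[ k < n ] (weight k * v k)

moment-+ : ∀ {n} (v w : Vector ℤ n) → moment (λ k → v k + w k) ≡ moment v + moment w
moment-+ v w = trans (sum-cong-≗ (λ k → ℤP.*-distribˡ-+ (weight k) (v k) (w k)))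
                     (∑-distrib-+ (λ k → weight k * v k) (λ k → weight k * w k))

moment-− : ∀ {n} (v w : Vector ℤ n) → moment (λ k → v k - w k) ≡ moment v - moment w
moment-− v w = trans (sum-cong-≗ (λ k → *-distribˡ-− (weight k) (v k) (w k)))
                     (∑-distrib-− (λ k → weight k * v k) (λ k → weight k * w k))

moment-σ : ∀ {n} (a b : Fin n) → a ≢ b → moment (σ a b) ≡ + toℕ a - + toℕ b
moment-σ {n} a b a≢b = begin
  moment (σ a b)                                          ≡⟨ sum-cong-≗ expand ⟩
  ∑[ k < n ] (weight k * e (toℕ a) k - weight k * e (toℕ b) k)
                                                          ≡⟨ ∑-distrib-− {n} (λ k → weight k * e (toℕ a) k)
                                                                             (λ k → weight k * e (toℕ b) k) ⟩
  ∑[ k < n ] (weight k * e (toℕ a) k) - ∑[ k < n ] (weight k * e (toℕ b) k)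
                                                          ≡⟨ cong₂ _-_ (∑-e weight a) (∑-e weight b) ⟩
  (1ℤ + + toℕ a) - (1ℤ + + toℕ b)                         ≡⟨ cancel (+ toℕ a) (+ toℕ b) ⟩
  + toℕ a - + toℕ b                                       ∎
  where
  expand : ∀ k → weight k * σ a b k ≡ weight k * e (toℕ a) k - weight k * e (toℕ b) k
  expand k = trans (cong (_*_ (weight k)) (σ≡e−e a b k a≢b))
                   (*-distribˡ-− (weight k) (e (toℕ a) k) (e (toℕ b) k))
  cancel : ∀ a b → (1ℤ + a) - (1ℤ + b) ≡ a - b
  cancel = solve-∀

signed-depth : ∀ {n} (T : TBlock n) (u v : ℤ) →
  (signℤ (TBlock.sign T) * (u * v)) * (+ toℕ (TBlock.k₁ T) - + toℕ (TBlock.k₂ T)) ≡ u * (v * - depth T)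
signed-depth T u v with TBlock.sign T
... | plus  = plusCase u v (+ toℕ (TBlock.k₁ T)) (+ toℕ (TBlock.k₂ T))
  where
  plusCase : ∀ u v a b → (1ℤ * (u * v)) * (a - b) ≡ u * (v * - (b - a))
  plusCase = solve-∀
... | minus = minusCase u v (+ toℕ (TBlock.k₁ T)) (+ toℕ (TBlock.k₂ T))
  where
  minusCase : ∀ u v a b → (-1ℤ * (u * v)) * (a - b) ≡ u * (v * - (a - b))
  minusCase = solve-∀

moment-tblock : ∀ {n} (T : TBlock n) i j →
  moment (tblock T i j) ≡ σ (TBlock.i₁ T) (TBlock.i₂ T) i * (σ (TBlock.j₁ T) (TBlock.j₂ T) j * - depth T)
moment-tblock {n} T i j = begin
  moment (tblock T i j)                              ≡⟨ sum-cong-≗ (λ k → regroup (weight k) s u v (σ k₁ k₂ k)) ⟩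
  ∑[ k < n ] ((s * (u * v)) * (weight k * σ k₁ k₂ k)) ≡⟨ *-distribˡ-sum (s * (u * v)) (λ k → weight k * σ k₁ k₂ k) ⟨
  (s * (u * v)) * moment (σ k₁ k₂)                   ≡⟨ cong (_*_ (s * (u * v))) (moment-σ k₁ k₂ (FP.<⇒≢ k₁<k₂)) ⟩
  (s * (u * v)) * (+ toℕ k₁ - + toℕ k₂)              ≡⟨ signed-depth T u v ⟩
  u * (v * - depth T)                                ∎
  where
  open TBlock T
  s = signℤ sign
  u = σ i₁ i₂ i
  v = σ j₁ j₂ j
  regroup : ∀ w s a b c → w * (s * (a * (b * c))) ≡ (s * (a * b)) * (w * c)
  regroup = solve-∀

ordered-pair-unique : ∀ {n} {a₁ a₂ b₁ b₂ : Fin n} → a₁ F.< a₂ → b₁ F.< b₂ →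
  (a₁ ≡ b₁ ⊎ a₁ ≡ b₂) → (a₂ ≡ b₁ ⊎ a₂ ≡ b₂) → (b₁ ≡ a₁ ⊎ b₁ ≡ a₂) → a₁ ≡ b₁ × a₂ ≡ b₂
ordered-pair-unique a< b< (inj₁ a₁≡b₁) (inj₂ a₂≡b₂) _           = a₁≡b₁ , a₂≡b₂
ordered-pair-unique a< b< (inj₁ refl)  (inj₁ refl)  _           = ⊥-elim (FP.<⇒≢ a< refl)
ordered-pair-unique a< b< (inj₂ refl)  _            (inj₁ refl) = ⊥-elim (FP.<⇒≢ b< refl)
ordered-pair-unique a< b< (inj₂ refl)  _            (inj₂ refl) = ⊥-elim (FP.<-asym a< b<)

sameLines⇒sameCorners : ∀ {n} (T T′ : TBlock n) → (∀ i j → Occupies T i j ⇔ Occupies T′ i j) →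
  (TBlock.i₁ T ≡ TBlock.i₁ T′ × TBlock.i₂ T ≡ TBlock.i₂ T′) ×
  (TBlock.j₁ T ≡ TBlock.j₁ T′ × TBlock.j₂ T ≡ TBlock.j₂ T′)
sameLines⇒sameCorners T T′ same =
  ordered-pair-unique (i₁<i₂ T) (i₁<i₂ T′)
    (proj₁ (to {i₁ T} {j₁ T} (inj₁ refl , inj₁ refl)))
    (proj₁ (to {i₂ T} {j₁ T} (inj₂ refl , inj₁ refl)))
    (proj₁ (from {i₁ T′} {j₁ T′} (inj₁ refl , inj₁ refl))) ,
  ordered-pair-unique (j₁<j₂ T) (j₁<j₂ T′)
    (proj₂ (to {i₁ T} {j₁ T} (inj₁ refl , inj₁ refl)))
    (proj₂ (to {i₁ T} {j₂ T} (inj₁ refl , inj₂ refl)))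
    (proj₂ (from {i₁ T′} {j₁ T′} (inj₁ refl , inj₁ refl)))
  where
  open TBlock
  to : ∀ {x y} → Occupies T x y → Occupies T′ x y
  to = Equivalence.to (same _ _)
  from : ∀ {x y} → Occupies T′ x y → Occupies T x y
  from = Equivalence.from (same _ _)

moment-pair : ∀ {n} (P : TPair n) i j → moment (pairHM P i j) ≡ 0ℤ
moment-pair P i j = begin
  moment (pairHM P i j)                                  ≡⟨ moment-+ (tblock T i j) (tblock T′ i j) ⟩
  moment (tblock T i j) + moment (tblock T′ i j)         ≡⟨ cong₂ _+_ (moment-tblock T i j) (moment-tblock T′ i j) ⟩
  u * (v * - depth T) + u′ * (v′ * - depth T′)           ≡⟨ cancel (cong₂ (λ a b → σ a b i) i₁≡ i₂≡)
                                                                   (cong₂ (λ a b → σ a b j) j₁≡ j₂≡)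
                                                                   (TPair.opposite P) ⟩
  0ℤ                                                     ∎
  where
  T  = TPair.fst P
  T′ = TPair.snd P
  u  = σ (TBlock.i₁ T) (TBlock.i₂ T) i
  v  = σ (TBlock.j₁ T) (TBlock.j₂ T) j
  u′ = σ (TBlock.i₁ T′) (TBlock.i₂ T′) i
  v′ = σ (TBlock.j₁ T′) (TBlock.j₂ T′) j
  corners = sameLines⇒sameCorners T T′ (TPair.sameLines P)
  i₁≡ = proj₁ (proj₁ corners)
  i₂≡ = proj₂ (proj₁ corners)
  j₁≡ = proj₁ (proj₂ corners)
  j₂≡ = proj₂ (proj₂ corners)
  cancel : ∀ {u u′ v v′ d d′} → u ≡ u′ → v ≡ v′ → d ≡ - d′ → u * (v * - d) + u′ * (v′ * - d′) ≡ 0ℤ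
  cancel {u} {v = v} {d′ = d′} refl refl refl = opposite u v d′
    where
    opposite : ∀ u v d → u * (v * - - d) + u * (v * - d) ≡ 0ℤ
    opposite = solve-∀

moment-sumPairs : ∀ {n} (ps : List (TPair n)) i j → moment (λ k → sumPairs ps i j k) ≡ 0ℤ
moment-sumPairs {n} []       i j =
  trans (sum-cong-≗ {n} (λ k → ℤP.*-zeroʳ (weight k))) (sum-replicate-zero n)
moment-sumPairs     (p ∷ ps) i j = begin
  moment (λ k → pairHM p i j k + sumPairs ps i j k)        ≡⟨ moment-+ (pairHM p i j) (λ k → sumPairs ps i j k) ⟩
  moment (pairHM p i j) + moment (λ k → sumPairs ps i j k) ≡⟨ cong₂ _+_ (moment-pair p i j) (moment-sumPairs ps i j) ⟩
  0ℤ                                                       ∎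

hgen : ∀ {n} → Fin n → Vector ℤ n
hgen x a = e (toℕ x) a - e 0 a

∑-hgen : ∀ {n} (v : Vector ℤ n) (a : Fin n) → ∑[ x < n ] (hgen x a * v x) ≡ v a - e 0 a * sum v
∑-hgen {n} v a = begin
  ∑[ x < n ] (hgen x a * v x)                         ≡⟨ sum-cong-≗ expand ⟩
  ∑[ x < n ] (v x * e (toℕ a) x - e 0 a * v x)        ≡⟨ ∑-distrib-− (λ x → v x * e (toℕ a) x) (λ x → e 0 a * v x) ⟩
  ∑[ x < n ] (v x * e (toℕ a) x) - ∑[ x < n ] (e 0 a * v x)
                                                     ≡⟨ cong₂ _-_ (∑-e v a) (sym (*-distribˡ-sum (e 0 a) v)) ⟩
  v a - e 0 a * sum v                                ∎
  where
  distribute : ∀ d c w → (d - c) * w ≡ w * d - c * w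
  distribute = solve-∀
  expand : ∀ x → hgen x a * v x ≡ v x * e (toℕ a) x - e 0 a * v x
  expand x = trans (distribute (e (toℕ x) a) (e 0 a) (v x))
                   (cong (λ d → v x * d - e 0 a * v x) (δ-sym (toℕ a) (toℕ x)))

minus-times-zero : ∀ x y → x - y * 0ℤ ≡ x
minus-times-zero = solve-∀

reconstruct-h : ∀ {n} (v : Vector ℤ n) → sum v ≡ 0ℤ → ∀ a → ∑[ x < n ] (hgen x a * v x) ≡ v a
reconstruct-h v Σv≡0 a = begin
  ∑[ x < _ ] (hgen x a * v x)  ≡⟨ ∑-hgen v a ⟩
  v a - e 0 a * sum v          ≡⟨ cong (λ s → v a - e 0 a * s) Σv≡0 ⟩
  v a - e 0 a * 0ℤ             ≡⟨ minus-times-zero (v a) (e 0 a) ⟩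
  v a                          ∎

vgen : ∀ {n} → ℕ → Vector ℤ n
vgen k c = (e k c - e 0 c) - + k * (e 1 c - e 0 c)

reconstruct-v : ∀ {n} (v : Vector ℤ n) → sum v ≡ 0ℤ → ∑[ k < n ] (+ toℕ k * v k) ≡ 0ℤ →
  ∀ c → ∑[ k < n ] (v k * vgen (toℕ k) c) ≡ v c
reconstruct-v {n} v Σv≡0 Σkv≡0 c = begin
  ∑[ k < n ] (v k * vgen (toℕ k) c)                         ≡⟨ sum-cong-≗ expand ⟩
  ∑[ k < n ] (hgen k c * v k - (e 1 c - e 0 c) * (+ toℕ k * v k))
                                                            ≡⟨ ∑-distrib-− (λ k → hgen k c * v k)
                                                                           (λ k → (e 1 c - e 0 c) * (+ toℕ k * v k)) ⟩
  ∑[ k < n ] (hgen k c * v k) - ∑[ k < n ] ((e 1 c - e 0 c) * (+ toℕ k * v k))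
                                                            ≡⟨ cong₂ _-_ (reconstruct-h v Σv≡0 c)
                                                                 (sym (*-distribˡ-sum (e 1 c - e 0 c) (λ k → + toℕ k * v k))) ⟩
  v c - (e 1 c - e 0 c) * ∑[ k < n ] (+ toℕ k * v k)         ≡⟨ cong (λ s → v c - (e 1 c - e 0 c) * s) Σkv≡0 ⟩
  v c - (e 1 c - e 0 c) * 0ℤ                                ≡⟨ minus-times-zero (v c) (e 1 c - e 0 c) ⟩
  v c                                                       ∎
  where
  regroup : ∀ w a b c K → w * ((a - b) - K * (c - b)) ≡ (a - b) * w - (c - b) * (K * w)
  regroup = solve-∀
  expand : ∀ k → v k * vgen (toℕ k) c ≡ hgen k c * v k - (e 1 c - e 0 c) * (+ toℕ k * v k)
  expand k = regroup (v k) (e (toℕ k) c) (e 0 c) (e 1 c) (+ toℕ k)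

generator : ∀ {n} → Fin n → Fin n → ℕ → Hypermatrix n
generator x y k a b c = hgen x a * (hgen y b * vgen k c)

moment⇒firstMoment : ∀ {n} (v : Vector ℤ n) → moment v ≡ 0ℤ → sum v ≡ 0ℤ → ∑[ k < n ] (+ toℕ k * v k) ≡ 0ℤ
moment⇒firstMoment {n} v m≡0 Σv≡0 = begin
  ∑[ k < n ] (+ toℕ k * v k)             ≡⟨ sum-cong-≗ (λ k → shift (+ toℕ k) (v k)) ⟩
  ∑[ k < n ] (weight k * v k - v k)      ≡⟨ ∑-distrib-− (λ k → weight k * v k) v ⟩
  moment v - sum v                       ≡⟨ cong₂ _-_ m≡0 Σv≡0 ⟩
  0ℤ                                     ∎
  where
  shift : ∀ K w → K * w ≡ (1ℤ + K) * w - w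
  shift = solve-∀

-- A balanced hypermatrix with zero moments is Σ_{x,y,k} D_xyk · g_x ⊗ g_y ⊗ f_k:
-- reconstruct each vertical line, then each column, then each row.
decomposition : ∀ {n} (D : Hypermatrix n) → Balanced D → (∀ i j → moment (D i j) ≡ 0ℤ) →
  ∀ a b c → ∑[ x < n ] ∑[ y < n ] ∑[ k < n ] (D x y k * generator x y (toℕ k) a b c) ≡ D a b c
decomposition {n} D bal moments a b c = begin
  ∑[ x < n ] ∑[ y < n ] ∑[ k < n ] (D x y k * generator x y (toℕ k) a b c)
    ≡⟨ sum-cong-≗ (λ x → sum-cong-≗ (λ y → vertical x y)) ⟩
  ∑[ x < n ] ∑[ y < n ] (hgen x a * (hgen y b * D x y c))
    ≡⟨ sum-cong-≗ column ⟩
  ∑[ x < n ] (hgen x a * D x b c)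
    ≡⟨ reconstruct-h (λ x → D x b c) (rowSums b c) a ⟩
  D a b c ∎
  where
  open Balanced bal
  regroup : ∀ d u v f → d * (u * (v * f)) ≡ u * (v * (d * f))
  regroup = solve-∀
  vertical : ∀ x y → ∑[ k < n ] (D x y k * generator x y (toℕ k) a b c) ≡ hgen x a * (hgen y b * D x y c)
  vertical x y = begin
    ∑[ k < n ] (D x y k * (hgen x a * (hgen y b * vgen (toℕ k) c)))
      ≡⟨ sum-cong-≗ (λ k → regroup (D x y k) (hgen x a) (hgen y b) (vgen (toℕ k) c)) ⟩
    ∑[ k < n ] (hgen x a * (hgen y b * (D x y k * vgen (toℕ k) c)))
      ≡⟨ *-distribˡ-sum (hgen x a) (λ k → hgen y b * (D x y k * vgen (toℕ k) c)) ⟨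
    hgen x a * ∑[ k < n ] (hgen y b * (D x y k * vgen (toℕ k) c))
      ≡⟨ cong (_*_ (hgen x a)) (*-distribˡ-sum (hgen y b) (λ k → D x y k * vgen (toℕ k) c)) ⟨
    hgen x a * (hgen y b * ∑[ k < n ] (D x y k * vgen (toℕ k) c))
      ≡⟨ cong (λ s → hgen x a * (hgen y b * s)) (reconstruct-v (D x y) (vertSums x y)
            (moment⇒firstMoment (D x y) (moments x y) (vertSums x y)) c) ⟩
    hgen x a * (hgen y b * D x y c) ∎
  column : ∀ x → ∑[ y < n ] (hgen x a * (hgen y b * D x y c)) ≡ hgen x a * D x b c
  column x = begin
    ∑[ y < n ] (hgen x a * (hgen y b * D x y c)) ≡⟨ *-distribˡ-sum (hgen x a) (λ y → hgen y b * D x y c) ⟨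
    hgen x a * ∑[ y < n ] (hgen y b * D x y c)   ≡⟨ cong (_*_ (hgen x a)) (reconstruct-h (λ y → D x y c) (colSums x c) b) ⟩
    hgen x a * D x b c                           ∎

product-zero : ∀ u v w → u ≡ 0ℤ ⊎ v ≡ 0ℤ ⊎ w ≡ 0ℤ → u * (v * w) ≡ 0ℤ
product-zero _ v w (inj₁ refl)        = ℤP.*-zeroˡ (v * w)
product-zero u _ w (inj₂ (inj₁ refl)) = trans (cong (_*_ u) (ℤP.*-zeroˡ w)) (ℤP.*-zeroʳ u)
product-zero u v _ (inj₂ (inj₂ refl)) = trans (cong (_*_ u) (ℤP.*-zeroʳ v)) (ℤP.*-zeroʳ u)

hgen-zero : ∀ {n} (a : Fin (suc n)) → hgen zero a ≡ 0ℤ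
hgen-zero a = ℤP.+-inverseʳ (e 0 a)

vgen-zero : ∀ {n} (c : Fin n) → vgen 0 c ≡ 0ℤ
vgen-zero c = vanish (e 0 c) (e 1 c)
  where
  vanish : ∀ z o → (z - z) - 0ℤ * (o - z) ≡ 0ℤ
  vanish = solve-∀

vgen-step : ∀ {n} k (c : Fin n) → vgen (suc k) c ≡ vgen k c + ((e 0 c - e 1 c) - (e k c - e (suc k) c))
vgen-step k c = telescope (e (suc k) c) (e k c) (e 0 c) (e 1 c) (+ k)
  where
  telescope : ∀ a′ a z o K → (a′ - z) - (1ℤ + K) * (o - z) ≡ ((a - z) - K * (o - z)) + ((z - o) - (a - a′))
  telescope = solve-∀

unitPair : ∀ {m} (x y : Fin (suc m)) {k} → suc k ℕ.< suc (suc m) → TPair (suc (suc m))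
unitPair x y {k} k+1<n = record
  { fst       = record { sign = plus ; i₁ = zero ; i₂ = suc x ; j₁ = zero ; j₂ = suc y
                       ; k₁ = zero ; k₂ = suc zero
                       ; i₁<i₂ = s≤s z≤n ; j₁<j₂ = s≤s z≤n ; k₁<k₂ = s≤s z≤n }
  ; snd       = record { sign = minus ; i₁ = zero ; i₂ = suc x ; j₁ = zero ; j₂ = suc y
                       ; k₁ = fromℕ< k<n ; k₂ = fromℕ< k+1<n
                       ; i₁<i₂ = s≤s z≤n ; j₁<j₂ = s≤s z≤n ; k₁<k₂ = lower<upper }
  ; opposite  = cong -_ (sym lower-depth)
  ; sameLines = λ i j → mk⇔ id id
  }
  where
  k<n = ℕP.<-trans (ℕP.n<1+n k) k+1<n
  lower<upper : fromℕ< k<n F.< fromℕ< k+1<n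
  lower<upper = subst₂ ℕ._<_ (sym (FP.toℕ-fromℕ< k<n)) (sym (FP.toℕ-fromℕ< k+1<n)) (ℕP.n<1+n k)
  lower-depth : + toℕ (fromℕ< k<n) - + toℕ (fromℕ< k+1<n) ≡ -1ℤ
  lower-depth = trans (cong₂ (λ a b → + a - + b) (FP.toℕ-fromℕ< k<n) (FP.toℕ-fromℕ< k+1<n))
                      (unit-step (+ k))
    where
    unit-step : ∀ K → K - (1ℤ + K) ≡ -1ℤ
    unit-step = solve-∀

unitPair-entries : ∀ {m} (x y : Fin (suc m)) {k} (k+1<n : suc k ℕ.< suc (suc m)) a b c →
  pairHM (unitPair x y k+1<n) a b c ≡ hgen (suc x) a * (hgen (suc y) b * ((e 0 c - e 1 c) - (e k c - e (suc k) c)))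
unitPair-entries x y {k} k+1<n a b c =
  trans (cong₂ _+_ (cong (_*_ 1ℤ)  (cong₂ _*_ σa (cong₂ _*_ σb σ-upper)))
                   (cong (_*_ -1ℤ) (cong₂ _*_ σa (cong₂ _*_ σb σ-lower))))
        (signs (e 0 a) (e (suc (toℕ x)) a) (e 0 b) (e (suc (toℕ y)) b) _ _)
  where
  P = unitPair x y k+1<n
  open TBlock (TPair.snd P) using (k₁; k₂; k₁<k₂)
  σa : σ zero (suc x) a ≡ e 0 a - e (suc (toℕ x)) a
  σa = σ≡e−e zero (suc x) a (λ ())
  σb : σ zero (suc y) b ≡ e 0 b - e (suc (toℕ y)) b
  σb = σ≡e−e zero (suc y) b (λ ())
  σ-upper : σ zero (suc zero) c ≡ e 0 c - e 1 c
  σ-upper = σ≡e−e zero (suc zero) c (λ ())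
  σ-lower : σ k₁ k₂ c ≡ e k c - e (suc k) c
  σ-lower = trans (σ≡e−e k₁ k₂ c (FP.<⇒≢ k₁<k₂))
                  (cong₂ (λ i j → e i c - e j c) (FP.toℕ-fromℕ< _) (FP.toℕ-fromℕ< k+1<n))
  signs : ∀ z zx w wy p q → 1ℤ * ((z - zx) * ((w - wy) * p)) + -1ℤ * ((z - zx) * ((w - wy) * q))
                          ≡ (zx - z) * ((wy - w) * (p - q))
  signs = solve-∀

-- g_x ⊗ g_y ⊗ f_k (k < n) is a pair sum: it vanishes if x, y or k is 0, and otherwise
-- differs from g_x ⊗ g_y ⊗ f_{k−1} by one unit pair.
generator-isPairSum : ∀ {n} (x y : Fin n) (k : ℕ) → k ℕ.< n → IsPairSum (generator x y k)
generator-isPairSum zero    y       k       _ =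
  pairSum-≗ (λ a b c → sym (product-zero _ (hgen y b) (vgen k c) (inj₁ (hgen-zero a)))) pairSum-zero
generator-isPairSum (suc x) zero    k       _ =
  pairSum-≗ (λ a b c → sym (product-zero (hgen (suc x) a) _ (vgen k c) (inj₂ (inj₁ (hgen-zero b))))) pairSum-zero
generator-isPairSum (suc x) (suc y) zero    _ =
  pairSum-≗ (λ a b c → sym (product-zero (hgen (suc x) a) (hgen (suc y) b) _ (inj₂ (inj₂ (vgen-zero c))))) pairSum-zero
generator-isPairSum {suc zero} (suc ()) (suc y) (suc k) _
generator-isPairSum {suc (suc m)} (suc x) (suc y) (suc k) k+1<n =
  pairSum-≗ (λ a b c → sym (peel a b c))
    (pairSum-+ (generator-isPairSum (suc x) (suc y) k (ℕP.<-trans (ℕP.n<1+n k) k+1<n))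
               (pairSum-pair (unitPair x y k+1<n)))
  where
  distrib : ∀ u v f d → u * (v * (f + d)) ≡ u * (v * f) + u * (v * d)
  distrib = solve-∀
  peel : ∀ a b c → generator (suc x) (suc y) (suc k) a b c
                 ≡ generator (suc x) (suc y) k a b c + pairHM (unitPair x y k+1<n) a b c
  peel a b c = begin
    hgen (suc x) a * (hgen (suc y) b * vgen (suc k) c)
      ≡⟨ cong (λ f → hgen (suc x) a * (hgen (suc y) b * f)) (vgen-step k c) ⟩
    hgen (suc x) a * (hgen (suc y) b * (vgen k c + ((e 0 c - e 1 c) - (e k c - e (suc k) c))))
      ≡⟨ distrib (hgen (suc x) a) (hgen (suc y) b) (vgen k c) _ ⟩
    generator (suc x) (suc y) k a b c + hgen (suc x) a * (hgen (suc y) b * ((e 0 c - e 1 c) - (e k c - e (suc k) c)))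
      ≡⟨ cong (_+_ (generator (suc x) (suc y) k a b c)) (unitPair-entries x y k+1<n a b c) ⟨
    generator (suc x) (suc y) k a b c + pairHM (unitPair x y k+1<n) a b c ∎

balanced⇒pairSum : ∀ {n} (D : Hypermatrix n) → Balanced D → (∀ i j → moment (D i j) ≡ 0ℤ) → IsPairSum D
balanced⇒pairSum D bal moments =
  pairSum-≗ (decomposition D bal moments)
    (pairSum-∑ _ λ x → pairSum-∑ _ λ y → pairSum-∑ _ λ k →
      pairSum-scale (D x y k) (generator-isPairSum x y (toℕ k) (FP.toℕ<n k)))

theorem14 : (n : ℕ) → n ≥ 1 → (A B : Hypermatrix n) → IsASHM A → IsASHM B →
    ((∀ i j → ASHL A i j ≡ ASHL B i j) ⇔
     (∃ λ (ps : List (TPair n)) → ∀ i j k → A i j k - B i j k ≡ sumPairs ps i j k))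
theorem14 n _ A B isA isB = mk⇔ sameASHL⇒pairSum pairSum⇒sameASHL
  where
  D : Hypermatrix n
  D i j k = A i j k - B i j k
  moment-D : ∀ i j → moment (D i j) ≡ ASHL A i j - ASHL B i j
  moment-D i j = trans (moment-− (A i j) (B i j))
                       (sym (cong₂ _-_ (Σℤ≡sum (λ k → weight k * A i j k)) (Σℤ≡sum (λ k → weight k * B i j k))))
  sameASHL⇒pairSum : (∀ i j → ASHL A i j ≡ ASHL B i j) → IsPairSum D
  sameASHL⇒pairSum L≡ = balanced⇒pairSum D (ashm-difference-balanced isA isB)
    (λ i j → trans (moment-D i j) (trans (cong (λ l → l - ASHL B i j) (L≡ i j)) (ℤP.+-inverseʳ (ASHL B i j))))
  pairSum⇒sameASHL : IsPairSum D → ∀ i j → ASHL A i j ≡ ASHL B i j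
  pairSum⇒sameASHL (ps , D≡ps) i j = ℤP.i-j≡0⇒i≡j _ _ (begin
    ASHL A i j - ASHL B i j            ≡⟨ moment-D i j ⟨
    moment (D i j)                     ≡⟨ sum-cong-≗ (λ k → cong (_*_ (weight k)) (D≡ps i j k)) ⟩
    moment (λ k → sumPairs ps i j k)   ≡⟨ moment-sumPairs ps i j ⟩
    0ℤ                                 ∎)
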